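{- For every positive integer $n$, the sequence $(JL_{n,k})_{k \ge 0}$ is log-concave, i.e. $JL_{n,k}^2 \ge JL_{n,k-1}JL_{n,k+1}$ for all $1 \le k < \lfloor n/2 \rfloor$.
   Context: For integers $n \ge 1$ and $k \ge 0$, $JL_{n,k} = \sum_{i=k}^{\lfloor n/2 \rfloor} \frac{n}{n-i} \binom{n-i}{i} \binom{i}{k}$, where an empty sum equals $0$. -}

module Defs where

open import Data.Nat using (ℕ; zero; suc; _∸_; _/_; _≤?_)
open import Data.Nat.Combinatorics using (_C_)
open import Data.Integer using (+_)
open import Data.Rational using (ℚ; 0ℚ; _+_; _*_)
import Data.Rational as ℚ
open import Relation.Nullary using (yes; no)

-- The summand  n/(n-i) * C(n-i,i) * C(i,k)  as a rational number.
-- For n - i = 0 the summand never occurs in the range i ≤ ⌊n/2⌋ with n ≥ 1;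
-- we set it to 0 there (irrelevant for the statement).
term : ℕ → ℕ → ℕ → ℚ
term n k i with n ∸ i
... | zero  = 0ℚ
... | suc m = ((+ n) ℚ./ suc m) * (+ ((suc m C i) Data.Nat.* (i C k)) ℚ./ 1)

sumFromTo : ℕ → ℕ → (ℕ → ℚ) → ℚ
sumFromTo k zero    f with k ≤? 0
... | yes _ = f 0
... | no  _ = 0ℚ
sumFromTo k (suc u) f with k ≤? suc u
... | yes _ = sumFromTo k u f + f (suc u)
... | no  _ = sumFromTo k u f

JL : ℕ → ℕ → ℚ
JL n k = sumFromTo k (n / 2) (term n k)

{-# OPTIONS --safe #-}
module Submission where

open import Defs
open import Data.Nat using (ℕ; suc; _<_; _≤_; _/_; _∸_)

-- JL n k = Σᵢ aᵢ C(i,k) with aᵢ = n/(n-i) C(n-i,i) is the coefficient of xᵏ in A(1 + x), where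
-- A(x) = Σᵢ aᵢ xⁱ.  The aᵢ are log-concave, because a₍ᵢ₊₁₎/aᵢ = (n-2i)(n-2i-1)/((i+1)(n-i-1))
-- decreases in i, and their support is an initial segment.  Such sequences stay log-concave under
-- A(x) ↦ A(1 + x): from A(x) = a₀ + x A′(x) we get A(1 + x) = a₀ + (1 + x) A′(1 + x), the
-- coefficients qₖ of A′(1 + x) are log-concave by induction on the degree, and hence so are the
-- sums qₖ + qₖ₊₁, which are the coefficients bₖ₊₁ of A(1 + x).  The remaining inequality
-- b₀ b₂ ≤ b₁² involves a₀; in terms of the (again log-concave) tail sums Rₜ = Σ_{j ≥ t} aⱼ it reads
-- R₀ Σ_{s,u} R₍ₛ₊ᵤ₊₂₎ ≤ (Σₛ R₍ₛ₊₁₎)², which holds termwise since R₀ R₍ₛ₊ᵤ₊₂₎ ≤ R₍ₛ₊₁₎ R₍ᵤ₊₁₎.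

module FiniteSums where

  open import Data.Nat
  open import Data.Nat.Properties
  open import Algebra.Properties.CommutativeSemigroup +-commutativeSemigroup using (interchange)
  open import Relation.Binary.PropositionalEquality

  ∑≤ : ℕ → (ℕ → ℕ) → ℕ
  ∑≤ zero    f = f 0
  ∑≤ (suc N) f = f 0 + ∑≤ N (λ i → f (suc i))

  syntax ∑≤ N (λ i → e) = ∑[ i ≤ N ] e

  ∑≤-cong : ∀ N {f g} → (∀ i → f i ≡ g i) → ∑≤ N f ≡ ∑≤ N g
  ∑≤-cong zero    f≡g = f≡g 0
  ∑≤-cong (suc N) f≡g = cong₂ _+_ (f≡g 0) (∑≤-cong N (λ i → f≡g (suc i)))

  ∑≤-mono-≤ : ∀ N {f g} → (∀ i → f i ≤ g i) → ∑≤ N f ≤ ∑≤ N g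
  ∑≤-mono-≤ zero    f≤g = f≤g 0
  ∑≤-mono-≤ (suc N) f≤g = +-mono-≤ (f≤g 0) (∑≤-mono-≤ N (λ i → f≤g (suc i)))

  ∑≤-distrib-+ : ∀ N f g → ∑[ i ≤ N ] (f i + g i) ≡ ∑≤ N f + ∑≤ N g
  ∑≤-distrib-+ zero    f g = refl
  ∑≤-distrib-+ (suc N) f g = trans
    (cong (f 0 + g 0 +_) (∑≤-distrib-+ N (λ i → f (suc i)) (λ i → g (suc i))))
    (interchange (f 0) (g 0) _ _)

  *-distribˡ-∑≤ : ∀ N c f → c * ∑≤ N f ≡ ∑[ i ≤ N ] (c * f i)
  *-distribˡ-∑≤ zero    c f = refl
  *-distribˡ-∑≤ (suc N) c f =
    trans (*-distribˡ-+ c (f 0) _) (cong (c * f 0 +_) (*-distribˡ-∑≤ N c (λ i → f (suc i))))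

  ∑≤-last : ∀ N f → ∑≤ (suc N) f ≡ ∑≤ N f + f (suc N)
  ∑≤-last zero    f = refl
  ∑≤-last (suc N) f = trans (cong (f 0 +_) (∑≤-last N (λ i → f (suc i)))) (sym (+-assoc (f 0) _ _))

  ∑≤-drop-last : ∀ N f → f (suc N) ≡ 0 → ∑≤ (suc N) f ≡ ∑≤ N f
  ∑≤-drop-last N f f[1+N]≡0 =
    trans (∑≤-last N f) (trans (cong (∑≤ N f +_) f[1+N]≡0) (+-identityʳ (∑≤ N f)))

module LogConcavity where

  open import Data.Nat
  open import Data.Nat.Properties
  open import Data.Nat.Tactic.RingSolver using (solve-∀)
  open import Relation.Binary.PropositionalEquality
  open import Relation.Nullary using (yes; no)
  open FiniteSums

  -- The second field makes the support an initial segment; it is what makes a (1 + i) / a i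
  -- non-increasing (log-concavity alone allows 1, 0, 0, 1).
  record IsLogConcave (a : ℕ → ℕ) : Set where
    field
      log-concave   : ∀ i → a i * a (2 + i) ≤ a (1 + i) * a (1 + i)
      zeros-persist : ∀ i → a i ≡ 0 → a (1 + i) ≡ 0

  open IsLogConcave public

  VanishesAbove : ℕ → (ℕ → ℕ) → Set
  VanishesAbove N a = ∀ i → N < i → a i ≡ 0

  *-zeroʳ-≤ : ∀ m {n} c → n ≡ 0 → m * n ≤ c
  *-zeroʳ-≤ m c refl = ≤-trans (≤-reflexive (*-zeroʳ m)) z≤n

  private
    *-cancelʳ-≤-≢0 : ∀ m n {p q} → p ≢ 0 → q ≢ 0 → m * (p * q) ≤ n * (p * q) → m ≤ n
    *-cancelʳ-≤-≢0 m n p≢0 q≢0 =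
      *-cancelʳ-≤ m n _ {{m*n≢0 _ _ {{≢-nonZero p≢0}} {{≢-nonZero q≢0}}}}

    swap-middle : ∀ p q r s → p * q * (r * s) ≡ p * s * (r * q)
    swap-middle = solve-∀

  shift-lc : ∀ {a} → IsLogConcave a → ∀ k → IsLogConcave (λ i → a (i + k))
  shift-lc lc k = record
    { log-concave   = λ i → log-concave lc (i + k)
    ; zeros-persist = λ i → zeros-persist lc (i + k)
    }

  suc-lc : ∀ {a} → IsLogConcave a → IsLogConcave (λ i → a (suc i))
  suc-lc lc = record
    { log-concave   = λ i → log-concave lc (suc i)
    ; zeros-persist = λ i → zeros-persist lc (suc i)
    }

  head-only-lc : ∀ {a} → (∀ i → a (suc i) ≡ 0) → IsLogConcave a
  head-only-lc {a} tail≡0 = record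
    { log-concave   = λ i → *-zeroʳ-≤ (a i) _ (tail≡0 (suc i))
    ; zeros-persist = λ i _ → tail≡0 i
    }

  nonzero-below : ∀ {a} → IsLogConcave a → ∀ {i j} → i ≤ j → a j ≢ 0 → a i ≢ 0
  nonzero-below {a} lc {i} {j} i≤j aj≢0 ai≡0 =
    aj≢0 (subst (λ m → a m ≡ 0) (m∸n+n≡m i≤j) (zero-above (j ∸ i)))
    where
    zero-above : ∀ d → a (d + i) ≡ 0
    zero-above zero    = ai≡0
    zero-above (suc d) = zeros-persist lc (d + i) (zero-above d)

  ratio-antitone : ∀ {a} → IsLogConcave a → ∀ e → a 0 * a (suc e) ≤ a 1 * a e
  ratio-antitone {a} lc zero    = ≤-reflexive (*-comm (a 0) (a 1))
  ratio-antitone {a} lc (suc e) with a (2 + e) ≟ 0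
  ... | yes top≡0 = *-zeroʳ-≤ (a 0) _ top≡0
  ... | no  top≢0 = *-cancelʳ-≤-≢0 _ _
    (nonzero-below lc (m≤n+m e 2) top≢0) (nonzero-below lc (m≤n+m (1 + e) 1) top≢0) (begin
      a 0 * a (2 + e) * (a e * a (1 + e))      ≡⟨ swap-middle (a 0) (a (2 + e)) (a e) (a (1 + e)) ⟩
      (a 0 * a (1 + e)) * (a e * a (2 + e))    ≤⟨ *-mono-≤ (ratio-antitone lc e) (log-concave lc e) ⟩
      (a 1 * a e) * (a (1 + e) * a (1 + e))    ≡⟨ regroup (a 1) (a e) (a (1 + e)) ⟩
      a 1 * a (1 + e) * (a e * a (1 + e))      ∎)
    where
    open ≤-Reasoning
    regroup : ∀ p q r → p * q * (r * r) ≡ p * r * (q * r)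
    regroup = solve-∀

  outer≤inner : ∀ {a} → IsLogConcave a → ∀ d e → a 0 * a (d + e) ≤ a d * a e
  outer≤inner {a} lc zero    e = ≤-refl
  outer≤inner {a} lc (suc d) e with a (suc d + e) ≟ 0
  ... | yes top≡0 = *-zeroʳ-≤ (a 0) _ top≡0
  ... | no  top≢0 = *-cancelʳ-≤-≢0 _ _
    (nonzero-below lc (s≤s z≤n) top≢0) (nonzero-below lc (s≤s (m≤n+m e d)) top≢0) (begin
      a 0 * a (suc d + e) * (a 1 * a (suc e))     ≡⟨ swap-middle (a 0) (a (suc d + e)) (a 1) (a (suc e)) ⟩
      (a 0 * a (suc e)) * (a 1 * a (suc d + e))   ≤⟨ *-mono-≤ (ratio-antitone lc e) (outer≤inner (suc-lc lc) d e) ⟩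
      (a 1 * a e) * (a (suc d) * a (suc e))       ≡⟨ regroup (a 1) (a e) (a (suc d)) (a (suc e)) ⟩
      a (suc d) * a e * (a 1 * a (suc e))         ∎)
    where
    open ≤-Reasoning
    regroup : ∀ p q r s → p * q * (r * s) ≡ r * q * (p * s)
    regroup = solve-∀

  pairwise-sums-log-concave : ∀ {q} → IsLogConcave q → ∀ k →
    (q k + q (1 + k)) * (q (2 + k) + q (3 + k)) ≤ (q (1 + k) + q (2 + k)) * (q (1 + k) + q (2 + k))
  pairwise-sums-log-concave {q} lc k = begin
    (w + x) * (y + z)                   ≡⟨ expand w x y z ⟩
    w * y + (w * z + (x * y + x * z))   ≤⟨ +-mono-≤ (log-concave lc k)
                                             (+-mono-≤ wz≤xy (+-monoʳ-≤ (x * y) (log-concave lc (1 + k)))) ⟩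
    x * x + (x * y + (x * y + y * y))   ≡⟨ square x y ⟩
    (x + y) * (x + y)                   ∎
    where
    open ≤-Reasoning
    w x y z : ℕ
    w = q k
    x = q (1 + k)
    y = q (2 + k)
    z = q (3 + k)
    wz≤xy : w * z ≤ x * y
    wz≤xy = outer≤inner (shift-lc lc k) 1 2
    expand : ∀ w x y z → (w + x) * (y + z) ≡ w * y + (w * z + (x * y + x * z))
    expand = solve-∀
    square : ∀ x y → x * x + (x * y + (x * y + y * y)) ≡ (x + y) * (x + y)
    square = solve-∀

  double-sum≤square : ∀ {c} → IsLogConcave c → ∀ N →
    c 0 * ∑[ s ≤ N ] ∑[ u ≤ N ] c (suc s + suc u) ≤ ∑[ s ≤ N ] c (suc s) * ∑[ s ≤ N ] c (suc s)
  double-sum≤square {c} lc N = begin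
    c 0 * ∑[ s ≤ N ] ∑[ u ≤ N ] c (suc s + suc u)     ≡⟨ *-distribˡ-∑≤ N (c 0) _ ⟩
    ∑[ s ≤ N ] (c 0 * ∑[ u ≤ N ] c (suc s + suc u))   ≡⟨ ∑≤-cong N (λ s → *-distribˡ-∑≤ N (c 0) _) ⟩
    ∑[ s ≤ N ] ∑[ u ≤ N ] (c 0 * c (suc s + suc u))   ≤⟨ ∑≤-mono-≤ N (λ s → ∑≤-mono-≤ N (λ u →
                                                           outer≤inner lc (suc s) (suc u))) ⟩
    ∑[ s ≤ N ] ∑[ u ≤ N ] (c (suc s) * c (suc u))     ≡⟨ ∑≤-cong N (λ s → *-distribˡ-∑≤ N (c (suc s)) _) ⟨
    ∑[ s ≤ N ] (c (suc s) * S)                        ≡⟨ ∑≤-cong N (λ s → *-comm (c (suc s)) S) ⟩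
    ∑[ s ≤ N ] (S * c (suc s))                        ≡⟨ *-distribˡ-∑≤ N S _ ⟨
    S * S                                             ∎
    where
    open ≤-Reasoning
    S : ℕ
    S = ∑[ s ≤ N ] c (suc s)

  tailSum : (ℕ → ℕ) → ℕ → ℕ → ℕ
  tailSum a N t = ∑[ j ≤ N ] a (t + j)

  tailSum-step : ∀ {N a} → VanishesAbove N a → ∀ t → tailSum a N t ≡ a t + tailSum a N (suc t)
  tailSum-step {N} {a} vanish t = begin
    ∑[ j ≤ N ] a (t + j)
      ≡⟨ ∑≤-drop-last N _ (vanish (t + suc N) (m≤n+m (suc N) t)) ⟨
    a (t + 0) + ∑[ j ≤ N ] a (t + suc j)
      ≡⟨ cong₂ _+_ (cong a (+-identityʳ t)) (∑≤-cong N (λ j → cong a (+-suc t j))) ⟩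
    a t + ∑[ j ≤ N ] a (suc t + j)
      ∎
    where open ≡-Reasoning

  tailSum-lc : ∀ {N a} → IsLogConcave a → VanishesAbove N a → IsLogConcave (tailSum a N)
  tailSum-lc {N} {a} lc vanish = record
    { log-concave   = tail-log-concave
    ; zeros-persist = λ t R≡0 → m+n≡0⇒n≡0 (a t) (trans (sym (tailSum-step vanish t)) R≡0)
    }
    where
    R : ℕ → ℕ
    R = tailSum a N
    head≤ : ∀ t → a t * R (2 + t) ≤ a (1 + t) * R (1 + t)
    head≤ t = begin
      a t * R (2 + t)                          ≡⟨ *-distribˡ-∑≤ N (a t) _ ⟩
      ∑[ j ≤ N ] (a t * a (2 + t + j))         ≤⟨ ∑≤-mono-≤ N termwise ⟩
      ∑[ j ≤ N ] (a (1 + t) * a (1 + t + j))   ≡⟨ *-distribˡ-∑≤ N (a (1 + t)) _ ⟨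
      a (1 + t) * R (1 + t)                    ∎
      where
      open ≤-Reasoning
      termwise : ∀ j → a t * a (2 + t + j) ≤ a (1 + t) * a (1 + t + j)
      termwise j = subst (λ m → a t * a (2 + m) ≤ a (1 + t) * a (1 + m)) (+-comm j t)
                         (outer≤inner (shift-lc lc t) 1 (suc j))
    tail-log-concave : ∀ t → R t * R (2 + t) ≤ R (1 + t) * R (1 + t)
    tail-log-concave t = begin
      R t * R (2 + t)                                ≡⟨ cong (_* R (2 + t)) (tailSum-step vanish t) ⟩
      (a t + R (1 + t)) * R (2 + t)                  ≡⟨ *-distribʳ-+ (R (2 + t)) (a t) (R (1 + t)) ⟩
      a t * R (2 + t) + R (1 + t) * R (2 + t)        ≤⟨ +-monoˡ-≤ _ (head≤ t) ⟩
      a (1 + t) * R (1 + t) + R (1 + t) * R (2 + t)  ≡⟨ factor (a (1 + t)) (R (1 + t)) (R (2 + t)) ⟩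
      R (1 + t) * (a (1 + t) + R (2 + t))            ≡⟨ cong (R (1 + t) *_) (tailSum-step vanish (1 + t)) ⟨
      R (1 + t) * R (1 + t)                          ∎
      where
      open ≤-Reasoning
      factor : ∀ x y z → x * y + y * z ≡ y * (x + z)
      factor = solve-∀

module BinomialTransform where

  open import Data.Nat
  open import Data.Nat.Properties
  open import Data.Nat.Combinatorics using (_C_; nCk+nC[k+1]≡[n+1]C[k+1])
  open import Relation.Binary.PropositionalEquality
  open FiniteSums
  open LogConcavity

  binomialTransform : (ℕ → ℕ) → ℕ → ℕ → ℕ
  binomialTransform a N k = ∑[ i ≤ N ] (a i * (i C k))

  vanish-suc : ∀ {N a} → VanishesAbove (suc N) a → VanishesAbove N (λ i → a (suc i))
  vanish-suc vanish i N<i = vanish (suc i) (s≤s N<i)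

  vanish-shift : ∀ {N a} → VanishesAbove N a → ∀ m → VanishesAbove N (λ i → a (m + i))
  vanish-shift vanish m i N<i = vanish (m + i) (≤-trans N<i (m≤n+m i m))

  transform-zero : ∀ a N → binomialTransform a N 0 ≡ ∑≤ N a
  transform-zero a N = ∑≤-cong N (λ i → *-identityʳ (a i))

  transform-head : ∀ a N →
    binomialTransform a (suc N) 0 ≡ a 0 + binomialTransform (λ i → a (suc i)) N 0
  transform-head a N = trans (transform-zero a (suc N)) (cong (a 0 +_) (sym (transform-zero _ N)))

  transform-pascal : ∀ a N k → binomialTransform a (suc N) (suc k) ≡
    binomialTransform (λ i → a (suc i)) N k + binomialTransform (λ i → a (suc i)) N (suc k)
  transform-pascal a N k = begin
    a 0 * 0 + ∑[ i ≤ N ] (a (suc i) * (suc i C suc k))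
      ≡⟨ cong₂ _+_ (*-zeroʳ (a 0)) (∑≤-cong N pascal) ⟩
    ∑[ i ≤ N ] (a (suc i) * (i C k) + a (suc i) * (i C suc k))
      ≡⟨ ∑≤-distrib-+ N _ _ ⟩
    ∑[ i ≤ N ] (a (suc i) * (i C k)) + ∑[ i ≤ N ] (a (suc i) * (i C suc k))
      ∎
    where
    open ≡-Reasoning
    pascal : ∀ i → a (suc i) * (suc i C suc k) ≡ a (suc i) * (i C k) + a (suc i) * (i C suc k)
    pascal i = trans (cong (a (suc i) *_) (sym (nCk+nC[k+1]≡[n+1]C[k+1] i k)))
                     (*-distribˡ-+ (a (suc i)) (i C k) (i C suc k))

  transform-drop-last : ∀ a N k → a (suc N) ≡ 0 →
    binomialTransform a (suc N) k ≡ binomialTransform a N k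
  transform-drop-last a N k a[1+N]≡0 = ∑≤-drop-last N _ (cong (_* (suc N C k)) a[1+N]≡0)

  -- The hockey-stick identity C(i, 1 + k) = Σ_{s < i} C(s, k), summed against a.
  transform-hockey : ∀ {N a} → VanishesAbove N a → ∀ k →
    binomialTransform a N (suc k) ≡ ∑[ s ≤ N ] binomialTransform (λ i → a (suc s + i)) N k
  transform-hockey {zero}  {a} vanish k =
    trans (*-zeroʳ (a 0)) (cong (_* (0 C k)) (sym (vanish 1 (s≤s z≤n))))
  transform-hockey {suc N} {a} vanish k = begin
    binomialTransform a (suc N) (suc k)
      ≡⟨ transform-pascal a N k ⟩
    binomialTransform a′ N k + binomialTransform a′ N (suc k)
      ≡⟨ cong (binomialTransform a′ N k +_) (transform-hockey (vanish-suc vanish) k) ⟩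
    binomialTransform a′ N k + ∑[ s ≤ N ] binomialTransform (λ i → a′ (suc s + i)) N k
      ≡⟨ cong₂ _+_ (drop-last 0) (∑≤-cong N (λ s → drop-last (suc s))) ⟨
    ∑[ s ≤ suc N ] binomialTransform (λ i → a (suc s + i)) (suc N) k
      ∎
    where
    open ≡-Reasoning
    a′ : ℕ → ℕ
    a′ i = a (suc i)
    drop-last : ∀ s → binomialTransform (λ i → a (suc s + i)) (suc N) k
                    ≡ binomialTransform (λ i → a (suc s + i)) N k
    drop-last s = transform-drop-last (λ i → a (suc s + i)) N k
                                      (vanish (suc s + suc N) (s≤s (m≤n+m (suc N) s)))

  transform-one : ∀ {N a} → VanishesAbove N a →
    binomialTransform a N 1 ≡ ∑[ s ≤ N ] tailSum a N (suc s)
  transform-one {N} vanish = trans (transform-hockey vanish 0) (∑≤-cong N (λ s → transform-zero _ N))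

  transform-two : ∀ {N a} → VanishesAbove N a →
    binomialTransform a N 2 ≡ ∑[ s ≤ N ] ∑[ u ≤ N ] tailSum a N (suc s + suc u)
  transform-two {N} {a} vanish = trans (transform-hockey vanish 1) (∑≤-cong N (λ s →
    trans (transform-one (vanish-shift vanish (suc s))) (∑≤-cong N (λ u → tailSum-shift (suc s) (suc u)))))
    where
    tailSum-shift : ∀ m t → tailSum (λ i → a (m + i)) N t ≡ tailSum a N (m + t)
    tailSum-shift m t = ∑≤-cong N (λ j → cong a (sym (+-assoc m t j)))

  transform-log-concave₀ : ∀ {N a} → IsLogConcave a → VanishesAbove N a →
    let b = binomialTransform a N in b 0 * b 2 ≤ b 1 * b 1
  transform-log-concave₀ {N} {a} lc vanish = begin
    b 0 * b 2
      ≡⟨ cong₂ _*_ (transform-zero a N) (transform-two vanish) ⟩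
    tailSum a N 0 * ∑[ s ≤ N ] ∑[ u ≤ N ] tailSum a N (suc s + suc u)
      ≤⟨ double-sum≤square (tailSum-lc lc vanish) N ⟩
    ∑[ s ≤ N ] tailSum a N (suc s) * ∑[ s ≤ N ] tailSum a N (suc s)
      ≡⟨ cong₂ _*_ (transform-one vanish) (transform-one vanish) ⟨
    b 1 * b 1
      ∎
    where
    open ≤-Reasoning
    b : ℕ → ℕ
    b = binomialTransform a N

  transform-lc : ∀ {N a} → IsLogConcave a → VanishesAbove N a → IsLogConcave (binomialTransform a N)
  transform-lc {zero}  {a} lc vanish = head-only-lc (λ i → *-zeroʳ (a 0))
  transform-lc {suc N} {a} lc vanish = record
    { log-concave   = λ where
        zero    → transform-log-concave₀ lc vanish
        (suc k) → begin
          b (1 + k) * b (3 + k)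
            ≡⟨ cong₂ _*_ (transform-pascal a N k) (transform-pascal a N (2 + k)) ⟩
          (q k + q (1 + k)) * (q (2 + k) + q (3 + k))
            ≤⟨ pairwise-sums-log-concave lcq k ⟩
          (q (1 + k) + q (2 + k)) * (q (1 + k) + q (2 + k))
            ≡⟨ cong₂ _*_ (transform-pascal a N (1 + k)) (transform-pascal a N (1 + k)) ⟨
          b (2 + k) * b (2 + k)
            ∎
    ; zeros-persist = λ where
        zero    b₀≡0 → let q₀≡0 = m+n≡0⇒n≡0 (a 0) (trans (sym (transform-head a N)) b₀≡0) in
          trans (transform-pascal a N 0) (cong₂ _+_ q₀≡0 (zeros-persist lcq 0 q₀≡0))
        (suc k) b≡0  → let q≡0 = m+n≡0⇒n≡0 (q k) (trans (sym (transform-pascal a N k)) b≡0) in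
          trans (transform-pascal a N (1 + k)) (cong₂ _+_ q≡0 (zeros-persist lcq (1 + k) q≡0))
    }
    where
    open ≤-Reasoning
    b q : ℕ → ℕ
    b = binomialTransform a (suc N)
    q = binomialTransform (λ i → a (suc i)) N
    lcq : IsLogConcave q
    lcq = transform-lc (suc-lc lc) (vanish-suc vanish)

module LucasCoefficients where

  open import Data.Nat
  open import Data.Nat.Properties
  open import Data.Nat.Combinatorics using (_C_; nCk+nC[k+1]≡[n+1]C[k+1]; nCk≡nC[n∸k]; nC1≡n)
  open import Data.Nat.DivMod using (m/n*n≤m; m*n/n≡m; /-monoˡ-≤)
  open import Data.Nat.Tactic.RingSolver using (solve-∀)
  open import Algebra.Properties.CommutativeSemigroup *-commutativeSemigroup using (x∙yz≈y∙xz; interchange)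
  open import Data.Sum using (inj₁; inj₂)
  open import Relation.Binary.PropositionalEquality
  open import Relation.Nullary using (yes; no; contradiction)
  open LogConcavity

  [1+k]*[1+n]C[1+k]≡[1+n]*nCk : ∀ n k → suc k * (suc n C suc k) ≡ suc n * (n C k)
  [1+k]*[1+n]C[1+k]≡[1+n]*nCk zero    zero    = refl
  [1+k]*[1+n]C[1+k]≡[1+n]*nCk zero    (suc k) = *-zeroʳ (2 + k)
  [1+k]*[1+n]C[1+k]≡[1+n]*nCk (suc n) zero    =
    trans (+-identityʳ _) (trans (nC1≡n (2 + n)) (sym (*-identityʳ (2 + n))))
  [1+k]*[1+n]C[1+k]≡[1+n]*nCk (suc n) (suc k) = begin
    (2 + k) * ((2 + n) C (2 + k))
      ≡⟨ cong ((2 + k) *_) (nCk+nC[k+1]≡[n+1]C[k+1] (1 + n) (1 + k)) ⟨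
    (2 + k) * (X + Y)
      ≡⟨ split k X Y ⟩
    (1 + k) * X + X + (2 + k) * Y
      ≡⟨ cong₂ (λ u v → u + X + v) ([1+k]*[1+n]C[1+k]≡[1+n]*nCk n k) ([1+k]*[1+n]C[1+k]≡[1+n]*nCk n (suc k)) ⟩
    (1 + n) * (n C k) + X + (1 + n) * (n C suc k)
      ≡⟨ merge n X (n C k) (n C suc k) ⟩
    X + (1 + n) * ((n C k) + (n C suc k))
      ≡⟨ cong (λ u → X + (1 + n) * u) (nCk+nC[k+1]≡[n+1]C[k+1] n k) ⟩
    (2 + n) * X
      ∎
    where
    open ≡-Reasoning
    X Y : ℕ
    X = (1 + n) C (1 + k)
    Y = (1 + n) C (2 + k)
    split : ∀ k x y → (2 + k) * (x + y) ≡ (1 + k) * x + x + (2 + k) * y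
    split = solve-∀
    merge : ∀ n x u v → (1 + n) * u + x + (1 + n) * v ≡ x + (1 + n) * (u + v)
    merge = solve-∀

  [m+n]Cm≡[n+m]Cn : ∀ m n → (m + n) C m ≡ (n + m) C n
  [m+n]Cm≡[n+m]Cn m n = begin
    (m + n) C m              ≡⟨ nCk≡nC[n∸k] (m≤m+n m n) ⟩
    (m + n) C (m + n ∸ m)    ≡⟨ cong ((m + n) C_) (m+n∸m≡n m n) ⟩
    (m + n) C n              ≡⟨ cong (_C n) (+-comm m n) ⟩
    (n + m) C n              ∎
    where open ≡-Reasoning

  [1+n]*[m+1+n]Cm≡[1+m+n]*[m+n]Cm : ∀ m n → suc n * ((m + suc n) C m) ≡ suc (m + n) * ((m + n) C m)
  [1+n]*[m+1+n]Cm≡[1+m+n]*[m+n]Cm m n = begin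
    suc n * ((m + suc n) C m)       ≡⟨ cong (suc n *_) ([m+n]Cm≡[n+m]Cn m (suc n)) ⟩
    suc n * (suc (n + m) C suc n)   ≡⟨ [1+k]*[1+n]C[1+k]≡[1+n]*nCk (n + m) n ⟩
    suc (n + m) * ((n + m) C n)     ≡⟨ cong₂ (λ u v → suc u * v) (+-comm m n) ([m+n]Cm≡[n+m]Cn m n) ⟨
    suc (m + n) * ((m + n) C m)     ∎
    where open ≡-Reasoning

  0<[m+n]Cm : ∀ m n → 0 < (m + n) C m
  0<[m+n]Cm zero    n = z<s
  0<[m+n]Cm (suc m) n = <-≤-trans (0<[m+n]Cm m n)
    (≤-trans (m≤m+n _ _) (≤-reflexive (nCk+nC[k+1]≡[n+1]C[k+1] (m + n) m)))

  -- For n = i + i + r, lucas i r = C(n-i, i) + C(n-i-1, i-1) = n/(n-i) C(n-i, i) is the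
  -- coefficient aᵢ of JL n; lucasSeq n extends it by 0 beyond ⌊n/2⌋.
  lucas : ℕ → ℕ → ℕ
  lucas zero    r = 1
  lucas (suc i) r = ((suc i + r) C suc i) + ((i + r) C i)

  0<lucas : ∀ i r → 0 < lucas i r
  0<lucas zero    r = z<s
  0<lucas (suc i) r = <-≤-trans (0<[m+n]Cm i r) (m≤n+m _ _)

  lucas-spec : ∀ i r → (i + r) * lucas i r ≡ (i + i + r) * ((i + r) C i)
  lucas-spec zero    r = refl
  lucas-spec (suc i) r = begin
    (suc i + r) * (X + ((i + r) C i))
      ≡⟨ *-distribˡ-+ (suc i + r) X _ ⟩
    (suc i + r) * X + suc (i + r) * ((i + r) C i)
      ≡⟨ cong ((suc i + r) * X +_) ([1+k]*[1+n]C[1+k]≡[1+n]*nCk (i + r) i) ⟨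
    (suc i + r) * X + suc i * X
      ≡⟨ collect i r X ⟩
    (suc i + suc i + r) * X
      ∎
    where
    open ≡-Reasoning
    X : ℕ
    X = (suc i + r) C suc i
    collect : ∀ i r x → (suc i + r) * x + suc i * x ≡ (suc i + suc i + r) * x
    collect = solve-∀

  lucas-ratio : ∀ i s → suc i * (suc i + s) * lucas (suc i) s ≡ (2 + s) * (1 + s) * lucas i (2 + s)
  lucas-ratio i s = *-cancelˡ-≡ _ _ (2 + i + s) (trans (cong ((2 + i + s) *_) lhs) (sym rhs))
    where
    open ≡-Reasoning
    c P : ℕ
    c = (i + s) C i
    P = (suc i + suc i + s) * (suc (i + s) * c)
    lhs : suc i * (suc i + s) * lucas (suc i) s ≡ P
    lhs = begin
      suc i * (suc i + s) * lucas (suc i) s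
        ≡⟨ *-assoc (suc i) (suc i + s) (lucas (suc i) s) ⟩
      suc i * ((suc i + s) * lucas (suc i) s)
        ≡⟨ cong (suc i *_) (lucas-spec (suc i) s) ⟩
      suc i * ((suc i + suc i + s) * ((suc i + s) C suc i))
        ≡⟨ x∙yz≈y∙xz (suc i) (suc i + suc i + s) ((suc i + s) C suc i) ⟩
      (suc i + suc i + s) * (suc i * ((suc i + s) C suc i))
        ≡⟨ cong ((suc i + suc i + s) *_) ([1+k]*[1+n]C[1+k]≡[1+n]*nCk (i + s) i) ⟩
      P ∎
    rhs : (2 + i + s) * ((2 + s) * (1 + s) * lucas i (2 + s)) ≡ (2 + i + s) * P
    rhs = begin
      (2 + i + s) * ((2 + s) * (1 + s) * lucas i (2 + s))
        ≡⟨ step₁ i s (lucas i (2 + s)) ⟩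
      (2 + s) * (1 + s) * ((i + (2 + s)) * lucas i (2 + s))
        ≡⟨ cong ((2 + s) * (1 + s) *_) (lucas-spec i (2 + s)) ⟩
      (2 + s) * (1 + s) * ((i + i + (2 + s)) * ((i + (2 + s)) C i))
        ≡⟨ step₂ i s ((i + (2 + s)) C i) ⟩
      (i + i + (2 + s)) * (1 + s) * ((2 + s) * ((i + (2 + s)) C i))
        ≡⟨ cong ((i + i + (2 + s)) * (1 + s) *_) ([1+n]*[m+1+n]Cm≡[1+m+n]*[m+n]Cm i (suc s)) ⟩
      (i + i + (2 + s)) * (1 + s) * (suc (i + suc s) * ((i + suc s) C i))
        ≡⟨ step₃ i s ((i + suc s) C i) ⟩
      (i + i + (2 + s)) * suc (i + suc s) * ((1 + s) * ((i + suc s) C i))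
        ≡⟨ cong ((i + i + (2 + s)) * suc (i + suc s) *_) ([1+n]*[m+1+n]Cm≡[1+m+n]*[m+n]Cm i s) ⟩
      (i + i + (2 + s)) * suc (i + suc s) * (suc (i + s) * c)
        ≡⟨ step₄ i s (suc (i + s) * c) ⟩
      (2 + i + s) * P ∎
      where
      step₁ : ∀ i s x → (2 + i + s) * ((2 + s) * (1 + s) * x) ≡ (2 + s) * (1 + s) * ((i + (2 + s)) * x)
      step₁ = solve-∀
      step₂ : ∀ i s x → (2 + s) * (1 + s) * ((i + i + (2 + s)) * x) ≡ (i + i + (2 + s)) * (1 + s) * ((2 + s) * x)
      step₂ = solve-∀
      step₃ : ∀ i s x → (i + i + (2 + s)) * (1 + s) * (suc (i + suc s) * x)
                      ≡ (i + i + (2 + s)) * suc (i + suc s) * ((1 + s) * x)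
      step₃ = solve-∀
      step₄ : ∀ i s x → (i + i + (2 + s)) * suc (i + suc s) * x ≡ (2 + i + s) * ((suc i + suc i + s) * x)
      step₄ = solve-∀

  ratios⇒log-concave : ∀ {x y z p q p′ q′} .{{_ : NonZero (q * p′)}} →
    p * y ≡ q * x → p′ * z ≡ q′ * y → p * q′ ≤ q * p′ → x * z ≤ y * y
  ratios⇒log-concave {x} {y} {z} {p} {q} {p′} {q′} py≡qx p′z≡q′y pq′≤qp′ =
    *-cancelʳ-≤ (x * z) (y * y) (q * p′) (begin
      x * z * (q * p′)     ≡⟨ pair-up x z q p′ ⟩
      (q * x) * (p′ * z)   ≡⟨ cong₂ _*_ (sym py≡qx) p′z≡q′y ⟩
      (p * y) * (q′ * y)   ≡⟨ interchange p y q′ y ⟩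
      (p * q′) * (y * y)   ≤⟨ *-monoˡ-≤ (y * y) pq′≤qp′ ⟩
      (q * p′) * (y * y)   ≡⟨ *-comm (q * p′) (y * y) ⟩
      y * y * (q * p′)     ∎)
    where
    open ≤-Reasoning
    pair-up : ∀ a b c d → a * b * (c * d) ≡ (c * a) * (d * b)
    pair-up = solve-∀

  lucas-log-concave : ∀ i t →
    lucas i (4 + t) * lucas (2 + i) t ≤ lucas (1 + i) (2 + t) * lucas (1 + i) (2 + t)
  lucas-log-concave i t =
    ratios⇒log-concave {x = lucas i (4 + t)} {y = lucas (1 + i) (2 + t)} {z = lucas (2 + i) t}
                       {p} {q} {p′} {q′}
      (lucas-ratio i (2 + t)) (lucas-ratio (suc i) t)
      (≤-trans (*-mono-≤ p≤p′ q′≤q) (≤-reflexive (*-comm p′ q)))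
    where
    p p′ q q′ : ℕ
    p  = suc i * (suc i + (2 + t))
    p′ = (2 + i) * (2 + i + t)
    q  = (4 + t) * (3 + t)
    q′ = (2 + t) * (1 + t)
    grow : ∀ i t → (2 + i) * (2 + i + t) ≡ suc i * (suc i + (2 + t)) + (1 + t)
    grow = solve-∀
    p≤p′ : p ≤ p′
    p≤p′ = ≤-trans (m≤m+n p (1 + t)) (≤-reflexive (sym (grow i t)))
    q′≤q : q′ ≤ q
    q′≤q = *-mono-≤ (m≤n+m (2 + t) 2) (m≤n+m (1 + t) 2)

  lucasSeq : ℕ → ℕ → ℕ
  lucasSeq n i with i + i ≤? n
  ... | yes _ = lucas i (n ∸ (i + i))
  ... | no  _ = 0

  lucasSeq-≡ : ∀ {n} i r → n ≡ i + i + r → lucasSeq n i ≡ lucas i r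
  lucasSeq-≡ {n} i r n≡ with i + i ≤? n
  ... | yes _     = cong (lucas i) (trans (cong (_∸ (i + i)) n≡) (m+n∸m≡n (i + i) r))
  ... | no  i+i≰n = contradiction (≤-trans (m≤m+n (i + i) r) (≤-reflexive (sym n≡))) i+i≰n

  lucasSeq-≡0 : ∀ {n} i → n < i + i → lucasSeq n i ≡ 0
  lucasSeq-≡0 {n} i n<i+i with i + i ≤? n
  ... | yes i+i≤n = contradiction i+i≤n (<⇒≱ n<i+i)
  ... | no  _     = refl

  private
    i+i≡i*2 : ∀ i → i + i ≡ i * 2
    i+i≡i*2 = solve-∀

  i≤n/2⇒i+i≤n : ∀ {i n} → i ≤ n / 2 → i + i ≤ n
  i≤n/2⇒i+i≤n {i} {n} i≤n/2 = begin
    i + i      ≡⟨ i+i≡i*2 i ⟩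
    i * 2      ≤⟨ *-monoˡ-≤ 2 i≤n/2 ⟩
    n / 2 * 2  ≤⟨ m/n*n≤m n 2 ⟩
    n          ∎
    where open ≤-Reasoning

  i+i≤n⇒i≤n/2 : ∀ {i n} → i + i ≤ n → i ≤ n / 2
  i+i≤n⇒i≤n/2 {i} {n} i+i≤n = begin
    i          ≡⟨ m*n/n≡m i 2 ⟨
    i * 2 / 2  ≤⟨ /-monoˡ-≤ 2 (≤-trans (≤-reflexive (sym (i+i≡i*2 i))) i+i≤n) ⟩
    n / 2      ∎
    where open ≤-Reasoning

  lucasSeq-vanishes : ∀ n → VanishesAbove (n / 2) (lucasSeq n)
  lucasSeq-vanishes n i n/2<i = lucasSeq-≡0 i (≰⇒> (λ i+i≤n → <⇒≱ n/2<i (i+i≤n⇒i≤n/2 i+i≤n)))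

  lucasSeq-spec : ∀ {n i} → i + i ≤ n → n * ((n ∸ i) C i) ≡ (n ∸ i) * lucasSeq n i
  lucasSeq-spec {n} {i} i+i≤n = begin
    n * ((n ∸ i) C i)             ≡⟨ cong₂ (λ m l → m * (l C i)) n≡ n∸i≡ ⟩
    (i + i + r) * ((i + r) C i)   ≡⟨ lucas-spec i r ⟨
    (i + r) * lucas i r           ≡⟨ cong₂ _*_ n∸i≡ (lucasSeq-≡ i r n≡) ⟨
    (n ∸ i) * lucasSeq n i        ∎
    where
    open ≡-Reasoning
    r : ℕ
    r = n ∸ (i + i)
    n≡ : n ≡ i + i + r
    n≡ = sym (m+[n∸m]≡n i+i≤n)
    n∸i≡ : n ∸ i ≡ i + r
    n∸i≡ = trans (cong (_∸ i) (trans n≡ (+-assoc i i r))) (m+n∸m≡n i (i + r))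

  lucasSeq-lc : ∀ n → IsLogConcave (lucasSeq n)
  lucasSeq-lc n = record { log-concave = log-concave′ ; zeros-persist = zeros-persist′ }
    where
    log-concave′ : ∀ i → lucasSeq n i * lucasSeq n (2 + i) ≤ lucasSeq n (1 + i) * lucasSeq n (1 + i)
    log-concave′ i with ≤-<-connex ((2 + i) + (2 + i)) n
    ... | inj₂ n<4+2i = *-zeroʳ-≤ (lucasSeq n i) _ (lucasSeq-≡0 (2 + i) n<4+2i)
    ... | inj₁ 4+2i≤n = begin
      lucasSeq n i * lucasSeq n (2 + i)
        ≡⟨ cong₂ _*_ (lucasSeq-≡ i (4 + t) (trans n≡ (regroup₀ i t))) (lucasSeq-≡ (2 + i) t n≡) ⟩
      lucas i (4 + t) * lucas (2 + i) t
        ≤⟨ lucas-log-concave i t ⟩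
      lucas (1 + i) (2 + t) * lucas (1 + i) (2 + t)
        ≡⟨ cong₂ _*_ middle≡ middle≡ ⟨
      lucasSeq n (1 + i) * lucasSeq n (1 + i)
        ∎
      where
      open ≤-Reasoning
      t : ℕ
      t = n ∸ ((2 + i) + (2 + i))
      n≡ : n ≡ (2 + i) + (2 + i) + t
      n≡ = sym (m+[n∸m]≡n 4+2i≤n)
      regroup₀ : ∀ i t → (2 + i) + (2 + i) + t ≡ i + i + (4 + t)
      regroup₀ = solve-∀
      regroup₁ : ∀ i t → (2 + i) + (2 + i) + t ≡ (1 + i) + (1 + i) + (2 + t)
      regroup₁ = solve-∀
      middle≡ : lucasSeq n (1 + i) ≡ lucas (1 + i) (2 + t)
      middle≡ = lucasSeq-≡ (1 + i) (2 + t) (trans n≡ (regroup₁ i t))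
    zeros-persist′ : ∀ i → lucasSeq n i ≡ 0 → lucasSeq n (1 + i) ≡ 0
    zeros-persist′ i lucasSeq≡0 with ≤-<-connex (i + i) n
    ... | inj₁ i+i≤n = contradiction (trans (sym (lucasSeq-≡ i _ (sym (m+[n∸m]≡n i+i≤n)))) lucasSeq≡0)
                                     (≢-nonZero⁻¹ _ {{>-nonZero (0<lucas i _)}})
    ... | inj₂ n<i+i = lucasSeq-≡0 (1 + i) (<-≤-trans n<i+i (+-mono-≤ (n≤1+n i) (n≤1+n i)))

module RationalEmbedding where

  open import Data.Nat as ℕ using (ℕ; zero; suc; z≤n; _≤?_)
  import Data.Nat.Properties as ℕ
  open import Data.Nat.Combinatorics using (_C_; k>n⇒nCk≡0)
  open import Data.Nat.DivMod using (m/n<m)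
  open import Data.Integer as ℤ using (+_; +≤+)
  import Data.Integer.Properties as ℤ
  open import Data.Integer.Tactic.RingSolver using (solve-∀)
  open import Data.Rational as ℚ using (ℚ; toℚᵘ)
  open import Data.Rational.Properties
    using (toℚᵘ-injective; toℚᵘ-fromℚᵘ; toℚᵘ-homo-+; toℚᵘ-homo-*; toℚᵘ-cancel-≤)
  open import Data.Rational.Unnormalised as ℚᵘ using (mkℚᵘ; *≡*; *≤*)
  import Data.Rational.Unnormalised.Properties as ℚᵘ
  open import Relation.Binary.PropositionalEquality
  open import Relation.Nullary using (yes; no; contradiction)
  open FiniteSums
  open BinomialTransform
  open LucasCoefficients

  ι : ℕ → ℚ
  ι x = + x ℚ./ 1

  toℚᵘ-ι : ∀ x → toℚᵘ (ι x) ℚᵘ.≃ mkℚᵘ (+ x) 0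
  toℚᵘ-ι x = toℚᵘ-fromℚᵘ (mkℚᵘ (+ x) 0)

  ι-homo-+ : ∀ x y → ι (x ℕ.+ y) ≡ ι x ℚ.+ ι y
  ι-homo-+ x y = toℚᵘ-injective (begin
    toℚᵘ (ι (x ℕ.+ y))               ≈⟨ toℚᵘ-ι (x ℕ.+ y) ⟩
    mkℚᵘ (+ (x ℕ.+ y)) 0              ≈⟨ *≡* (trans (cong (ℤ._* + 1) (ℤ.pos-+ x y)) (over-one (+ x) (+ y))) ⟩
    mkℚᵘ (+ x) 0 ℚᵘ.+ mkℚᵘ (+ y) 0    ≈⟨ ℚᵘ.+-cong (toℚᵘ-ι x) (toℚᵘ-ι y) ⟨
    toℚᵘ (ι x) ℚᵘ.+ toℚᵘ (ι y)        ≈⟨ toℚᵘ-homo-+ (ι x) (ι y) ⟨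
    toℚᵘ (ι x ℚ.+ ι y)                ∎)
    where
    open ℚᵘ.≃-Reasoning
    over-one : ∀ a b → (a ℤ.+ b) ℤ.* + 1 ≡ (a ℤ.* + 1 ℤ.+ b ℤ.* + 1) ℤ.* + 1
    over-one = solve-∀

  ι-homo-* : ∀ x y → ι (x ℕ.* y) ≡ ι x ℚ.* ι y
  ι-homo-* x y = toℚᵘ-injective (begin
    toℚᵘ (ι (x ℕ.* y))               ≈⟨ toℚᵘ-ι (x ℕ.* y) ⟩
    mkℚᵘ (+ (x ℕ.* y)) 0              ≈⟨ *≡* (cong (ℤ._* + 1) (ℤ.pos-* x y)) ⟩
    mkℚᵘ (+ x) 0 ℚᵘ.* mkℚᵘ (+ y) 0    ≈⟨ ℚᵘ.*-cong (toℚᵘ-ι x) (toℚᵘ-ι y) ⟨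
    toℚᵘ (ι x) ℚᵘ.* toℚᵘ (ι y)        ≈⟨ toℚᵘ-homo-* (ι x) (ι y) ⟨
    toℚᵘ (ι x ℚ.* ι y)                ∎)
    where open ℚᵘ.≃-Reasoning

  ι-mono-≤ : ∀ {x y} → x ℕ.≤ y → ι x ℚ.≤ ι y
  ι-mono-≤ {x} {y} x≤y = toℚᵘ-cancel-≤ (begin
    toℚᵘ (ι x)    ≃⟨ toℚᵘ-ι x ⟩
    mkℚᵘ (+ x) 0  ≤⟨ *≤* (ℤ.*-monoʳ-≤-nonNeg (+ 1) (+≤+ x≤y)) ⟩
    mkℚᵘ (+ y) 0  ≃⟨ toℚᵘ-ι y ⟨
    toℚᵘ (ι y)    ∎)
    where open ℚᵘ.≤-Reasoning

  mkℚᵘ-*-≃ : ∀ n d x y → n ℕ.* x ≡ suc d ℕ.* y → mkℚᵘ (+ n) d ℚᵘ.* mkℚᵘ (+ x) 0 ℚᵘ.≃ mkℚᵘ (+ y) 0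
  mkℚᵘ-*-≃ n d x y nx≡[1+d]y = *≡* (begin
    (+ n ℤ.* + x) ℤ.* + 1     ≡⟨ ℤ.*-identityʳ _ ⟩
    + n ℤ.* + x               ≡⟨ ℤ.pos-* n x ⟨
    + (n ℕ.* x)               ≡⟨ cong +_ (trans nx≡[1+d]y (ℕ.*-comm (suc d) y)) ⟩
    + (y ℕ.* suc d)           ≡⟨ cong (λ m → + (y ℕ.* m)) (ℕ.*-identityʳ (suc d)) ⟨
    + (y ℕ.* (suc d ℕ.* 1))   ≡⟨ ℤ.pos-* y (suc d ℕ.* 1) ⟩
    + y ℤ.* + (suc d ℕ.* 1)   ∎)
    where open ≡-Reasoning

  [n/d]*ιx≡ιy : ∀ n d x y → n ℕ.* x ≡ suc d ℕ.* y → (+ n ℚ./ suc d) ℚ.* ι x ≡ ι y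
  [n/d]*ιx≡ιy n d x y nx≡[1+d]y = toℚᵘ-injective (begin
    toℚᵘ ((+ n ℚ./ suc d) ℚ.* ι x)         ≈⟨ toℚᵘ-homo-* (+ n ℚ./ suc d) (ι x) ⟩
    toℚᵘ (+ n ℚ./ suc d) ℚᵘ.* toℚᵘ (ι x)   ≈⟨ ℚᵘ.*-cong (toℚᵘ-fromℚᵘ (mkℚᵘ (+ n) d)) (toℚᵘ-ι x) ⟩
    mkℚᵘ (+ n) d ℚᵘ.* mkℚᵘ (+ x) 0         ≈⟨ mkℚᵘ-*-≃ n d x y nx≡[1+d]y ⟩
    mkℚᵘ (+ y) 0                            ≈⟨ toℚᵘ-ι y ⟨
    toℚᵘ (ι y)                              ∎)
    where open ℚᵘ.≃-Reasoning

  sumFromTo≡ι∑≤ : ∀ k u f g → (∀ i → i ℕ.≤ u → f i ≡ ι (g i)) → (∀ i → i ℕ.< k → g i ≡ 0) →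
    sumFromTo k u f ≡ ι (∑≤ u g)
  sumFromTo≡ι∑≤ k zero f g f≡ιg g≡0 with k ≤? 0
  ... | yes _   = f≡ιg 0 z≤n
  ... | no  k≰0 = cong ι (sym (g≡0 0 (ℕ.≰⇒> k≰0)))
  sumFromTo≡ι∑≤ k (suc u) f g f≡ιg g≡0 with k ≤? suc u
  ... | yes _ = begin
    sumFromTo k u f ℚ.+ f (suc u)   ≡⟨ cong₂ ℚ._+_ (sumFromTo≡ι∑≤ k u f g f≡ιg′ g≡0) (f≡ιg (suc u) ℕ.≤-refl) ⟩
    ι (∑≤ u g) ℚ.+ ι (g (suc u))    ≡⟨ ι-homo-+ (∑≤ u g) (g (suc u)) ⟨
    ι (∑≤ u g ℕ.+ g (suc u))        ≡⟨ cong ι (∑≤-last u g) ⟨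
    ι (∑≤ (suc u) g)                ∎
    where
    open ≡-Reasoning
    f≡ιg′ : ∀ i → i ℕ.≤ u → f i ≡ ι (g i)
    f≡ιg′ i i≤u = f≡ιg i (ℕ.m≤n⇒m≤1+n i≤u)
  ... | no  k≰ = begin
    sumFromTo k u f                 ≡⟨ sumFromTo≡ι∑≤ k u f g f≡ιg′ g≡0 ⟩
    ι (∑≤ u g)                      ≡⟨ cong ι (∑≤-drop-last u g (g≡0 (suc u) (ℕ.≰⇒> k≰))) ⟨
    ι (∑≤ (suc u) g)                ∎
    where
    open ≡-Reasoning
    f≡ιg′ : ∀ i → i ℕ.≤ u → f i ≡ ι (g i)
    f≡ιg′ i i≤u = f≡ιg i (ℕ.m≤n⇒m≤1+n i≤u)

  term≡ι : ∀ {n} k i → 1 ℕ.≤ n → i ℕ.≤ n ℕ./ 2 → term n k i ≡ ι (lucasSeq n i ℕ.* (i C k))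
  term≡ι {n} k i 1≤n i≤n/2 with n ℕ.∸ i in n∸i≡
  ... | zero  = contradiction (sym n∸i≡) (ℕ.<⇒≢ (ℕ.m<n⇒0<n∸m i<n))
    where
    i<n : i ℕ.< n
    i<n = ℕ.≤-<-trans i≤n/2 (m/n<m n 2 {{ℕ.>-nonZero 1≤n}} (ℕ.n<1+n 1))
  ... | suc m = [n/d]*ιx≡ιy n m ((suc m C i) ℕ.* (i C k)) (lucasSeq n i ℕ.* (i C k)) (begin
    n ℕ.* ((suc m C i) ℕ.* (i C k))          ≡⟨ ℕ.*-assoc n (suc m C i) (i C k) ⟨
    n ℕ.* (suc m C i) ℕ.* (i C k)            ≡⟨ cong (λ l → n ℕ.* (l C i) ℕ.* (i C k)) n∸i≡ ⟨
    n ℕ.* ((n ℕ.∸ i) C i) ℕ.* (i C k)        ≡⟨ cong (ℕ._* (i C k)) (lucasSeq-spec {n} {i} (i≤n/2⇒i+i≤n i≤n/2)) ⟩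
    (n ℕ.∸ i) ℕ.* lucasSeq n i ℕ.* (i C k)   ≡⟨ cong (λ l → l ℕ.* lucasSeq n i ℕ.* (i C k)) n∸i≡ ⟩
    suc m ℕ.* lucasSeq n i ℕ.* (i C k)       ≡⟨ ℕ.*-assoc (suc m) (lucasSeq n i) (i C k) ⟩
    suc m ℕ.* (lucasSeq n i ℕ.* (i C k))     ∎)
    where open ≡-Reasoning

  JL≡ι-transform : ∀ {n} k → 1 ℕ.≤ n → JL n k ≡ ι (binomialTransform (lucasSeq n) (n ℕ./ 2) k)
  JL≡ι-transform {n} k 1≤n = sumFromTo≡ι∑≤ k (n ℕ./ 2) (term n k) _
    (λ i i≤n/2 → term≡ι k i 1≤n i≤n/2)
    (λ i i<k → trans (cong (lucasSeq n i ℕ.*_) (k>n⇒nCk≡0 i<k)) (ℕ.*-zeroʳ (lucasSeq n i)))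

open import Data.Rational using (_*_)
import Data.Rational as ℚ
open import Data.Rational.Properties using (module ≤-Reasoning)
import Data.Nat as ℕ
open import Relation.Binary.PropositionalEquality using (cong₂)
open LogConcavity using (IsLogConcave; log-concave)
open BinomialTransform using (binomialTransform; transform-lc)
open LucasCoefficients using (lucasSeq; lucasSeq-lc; lucasSeq-vanishes)
open RationalEmbedding using (ι; ι-homo-*; ι-mono-≤; JL≡ι-transform)

theorem2p4 : (n : ℕ) → 1 ≤ n → (k : ℕ) → 1 ≤ k → k < n / 2 →
    JL n (k ∸ 1) * JL n (suc k) ℚ.≤ JL n k * JL n k
theorem2p4 n 1≤n (suc k) _ _ = begin
  JL n k * JL n (suc (suc k))         ≡⟨ cong₂ _*_ (JL≡ι-transform k 1≤n) (JL≡ι-transform (suc (suc k)) 1≤n) ⟩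
  ι (b k) * ι (b (suc (suc k)))       ≡⟨ ι-homo-* (b k) (b (suc (suc k))) ⟨
  ι (b k ℕ.* b (suc (suc k)))         ≤⟨ ι-mono-≤ (log-concave b-lc k) ⟩
  ι (b (suc k) ℕ.* b (suc k))         ≡⟨ ι-homo-* (b (suc k)) (b (suc k)) ⟩
  ι (b (suc k)) * ι (b (suc k))       ≡⟨ cong₂ _*_ (JL≡ι-transform (suc k) 1≤n) (JL≡ι-transform (suc k) 1≤n) ⟨
  JL n (suc k) * JL n (suc k)         ∎
  where
  open ≤-Reasoning
  b : ℕ → ℕ
  b = binomialTransform (lucasSeq n) (n / 2)
  b-lc : IsLogConcave b
  b-lc = transform-lc (lucasSeq-lc n) (lucasSeq-vanishes n)
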